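{- Let $\mathcal{M}=(X,\mathcal{C},\mathcal{V})$ be a path-connected closure model (with respect to a fixed index space $\mathcal{J}$) and $x_1,x_2\in X$. If $x_1$ and $x_2$ are INL-bisimilar, then they are Path-bisimilar (with respect to $\mathcal{J}$).
   Context: A closure space is $(X,\mathcal{C})$, $X$ non-empty, $\mathcal{C}:\mathcal{P}(X)\to\mathcal{P}(X)$ with $\mathcal{C}(\emptyset)=\emptyset$, $A\subseteq\mathcal{C}(A)$, $\mathcal{C}(A_1\cup A_2)=\mathcal{C}(A_1)\cup\mathcal{C}(A_2)$. $\mathcal{I}(A)=X\setminus\mathcal{C}(X\setminus A)$; a neighbourhood of $x$ is any $S$ with $x\in\mathcal{I}(S)$. A closure model is $(X,\mathcal{C},\mathcal{V})$ with $\mathcal{V}:AP\to\mathcal{P}(X)$, $AP$ a fixed set; $\mathcal{V}^{ -1}(x)=\{p:x\in\mathcal{V}(p)\}$. $f:(X_1,\mathcal{C}_1)\to(X_2,\mathcal{C}_2)$ is continuous if $f(\mathcal{C}_1(A))\subseteq\mathcal{C}_2(f(A))$ for all $A$. $A_1,A_2$ are separated if $A_1\cap\mathcal{C}(A_2)=\mathcal{C}(A_1)\cap A_2=\emptyset$; a space is connected if it is not the union of two non-empty separated sets. An index space $\mathcal{J}=(I,\mathcal{C}^{\mathcal{J}})$ is a connected closure space with a total order $\le$ having bottom element $0$. A path is a continuous map $\pi:\mathcal{J}\to(X,\mathcal{C})$; it is bounded if there is $\ell\in I$ with $\pi(\iota)=\pi(\ell)$ for all $\iota\ge\ell$, such an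 $\ell$ being called the length $\mathrm{len}(\pi)$. $\mathrm{BPaths^F}(x)$: bounded paths with $\pi(0)=x$; $\mathrm{BPaths^T}(x)$: bounded paths with $\pi(\mathrm{len}(\pi))=x$. $\mathcal{M}$ is path-connected if for all $x,x'$ there is a bounded path from $x$ to $x'$ (i.e. $\pi(0)=x$, $\pi(\mathrm{len}(\pi))=x'$). INL-bisimulation: non-empty $B\subseteq X\times X$ such that whenever $(x_1,x_2)\in B$: (1) $\mathcal{V}^{ -1}(x_1)=\mathcal{V}^{ -1}(x_2)$; (2) for every neighbourhood $S_1$ of $x_1$ there is a neighbourhood $S_2$ of $x_2$ such that (a) every $s_2\in S_2$ has $s_1\in S_1$ with $(s_1,s_2)\in B$ and (b) every $s_1\in S_1$ has $s_2\in S_2$ with $(s_1,s_2)\in B$; (3) for every neighbourhood $S_2$ of $x_2$ there is a neighbourhood $S_1$ of $x_1$ with the same two properties (a),(b). Path-bisimulation: non-empty $B$ such that whenever $(x_1,x_2)\in B$: (1) $\mathcal{V}^{ -1}(x_1)=\mathcal{V}^{ -1}(x_2)$; (2) for all $\pi_1\in\mathrm{BPaths^F}(x_1)$ there is $\pi_2\in\mathrm{BPaths^F}(x_2)$ with $(\pi_1(\mathrm{len}(\pi_1)),\pi_2(\mathrm{len}(\pi_2)))\in B$; (3) symmetrically from $x_2$; (4) for all $\pi_1\in\mathrm{BPaths^T}(x_1)$ there is $\pi_2\in\mathrm{BPaths^T}(x_2)$ with $(\pi_1(0),\pi_2(0))\in B$; (5) symmetrically. INL-/Path-bisimilar: contained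 in some INL-/Path-bisimulation. -}

module Defs where

open import Level using (0ℓ)
open import Data.Product using (Σ; Σ-syntax; _×_; _,_)
import Data.Product
open import Data.Sum using (_⊎_)
open import Relation.Nullary using (¬_)
open import Relation.Unary using (Pred; _⊆_; ∅; _∪_; _∩_; ∁; Satisfiable)
open import Relation.Binary using (Rel; IsTotalOrder)
open import Relation.Binary.PropositionalEquality using (_≡_)

-- Subsets of X are predicates  X → Set.  Since subsets are extensional
-- objects, the closure operator is required to respect extensional
-- equality of predicates (𝒞-resp).

record ClosureSpace : Set₁ where
  field
    Carrier  : Set
    inhabited : Carrier
    𝒞        : Pred Carrier 0ℓ → Pred Carrier 0ℓ
    𝒞-resp   : ∀ (A B : Pred Carrier 0ℓ) → A ⊆ B → B ⊆ A → 𝒞 A ⊆ 𝒞 B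
    𝒞-∅      : 𝒞 ∅ ⊆ ∅
    𝒞-ext    : ∀ (A : Pred Carrier 0ℓ) → A ⊆ 𝒞 A
    𝒞-∪₁     : ∀ (A₁ A₂ : Pred Carrier 0ℓ) → 𝒞 (A₁ ∪ A₂) ⊆ (𝒞 A₁ ∪ 𝒞 A₂)
    𝒞-∪₂     : ∀ (A₁ A₂ : Pred Carrier 0ℓ) → (𝒞 A₁ ∪ 𝒞 A₂) ⊆ 𝒞 (A₁ ∪ A₂)

module _ (S : ClosureSpace) where
  open ClosureSpace S

  𝓘 : Pred Carrier 0ℓ → Pred Carrier 0ℓ
  𝓘 A x = ¬ 𝒞 (∁ A) x

  Nbhd : Carrier → Pred Carrier 0ℓ → Set
  Nbhd x A = 𝓘 A x

  Separated : Pred Carrier 0ℓ → Pred Carrier 0ℓ → Set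
  Separated A₁ A₂ = ((A₁ ∩ 𝒞 A₂) ⊆ ∅) × ((𝒞 A₁ ∩ A₂) ⊆ ∅)

  Connected : Set₁
  Connected = ¬ (Σ[ A₁ ∈ Pred Carrier 0ℓ ] Σ[ A₂ ∈ Pred Carrier 0ℓ ]
                   ((∀ x → (A₁ ∪ A₂) x) × Satisfiable A₁ × Satisfiable A₂
                    × Separated A₁ A₂))

image : {A B : Set} → (A → B) → Pred A 0ℓ → Pred B 0ℓ
image {A} f P y = Σ[ x ∈ A ] (P x × f x ≡ y)

Continuous : (S₁ S₂ : ClosureSpace) →
             (ClosureSpace.Carrier S₁ → ClosureSpace.Carrier S₂) → Set₁
Continuous S₁ S₂ f =
  ∀ (A : Pred (ClosureSpace.Carrier S₁) 0ℓ) →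
    image f (ClosureSpace.𝒞 S₁ A) ⊆ ClosureSpace.𝒞 S₂ (image f A)

record IndexSpace : Set₁ where
  field
    space       : ClosureSpace
  open ClosureSpace space public
  field
    connected   : Connected space
    _≤_         : Rel Carrier 0ℓ
    isTotalOrder : IsTotalOrder _≡_ _≤_
    𝟎           : Carrier
    𝟎-bottom    : ∀ i → 𝟎 ≤ i

record ClosureModel (AP : Set) : Set₁ where
  field
    space : ClosureSpace
  open ClosureSpace space public
  field
    𝒱 : AP → Pred Carrier 0ℓ

module Paths {AP : Set} (𝒥 : IndexSpace) (M : ClosureModel AP) where
  open IndexSpace 𝒥 using (_≤_; 𝟎) renaming (Carrier to I)
  open ClosureModel M

  record Path : Set₁ where
    field
      π    : I → Carrier
      cont : Continuous (IndexSpace.space 𝒥) space π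

  open Path public

  IsLength : Path → I → Set
  IsLength p ℓ = ∀ ι → ℓ ≤ ι → π p ι ≡ π p ℓ

  BPath : Set₁
  BPath = Σ[ p ∈ Path ] Σ[ ℓ ∈ I ] IsLength p ℓ

  start : BPath → Carrier
  start (p , _ , _) = π p 𝟎

  end : BPath → Carrier
  end (p , ℓ , _) = π p ℓ

  BPathsF : Carrier → Set₁
  BPathsF x = Σ[ b ∈ BPath ] start b ≡ x

  BPathsT : Carrier → Set₁
  BPathsT x = Σ[ b ∈ BPath ] end b ≡ x

  PathConnected : Set₁
  PathConnected = ∀ x x' → Σ[ b ∈ BPath ] (start b ≡ x × end b ≡ x')

  SameLabels : Carrier → Carrier → Set
  SameLabels x₁ x₂ = ∀ p → (𝒱 p x₁ → 𝒱 p x₂) × (𝒱 p x₂ → 𝒱 p x₁)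

  Matched : Rel Carrier 0ℓ → Pred Carrier 0ℓ → Pred Carrier 0ℓ → Set
  Matched B S₁ S₂ =
    (∀ s₂ → S₂ s₂ → Σ[ s₁ ∈ Carrier ] (S₁ s₁ × B s₁ s₂)) ×
    (∀ s₁ → S₁ s₁ → Σ[ s₂ ∈ Carrier ] (S₂ s₂ × B s₁ s₂))

  record IsINLBisimulation (B : Rel Carrier 0ℓ) : Set₁ where
    field
      nonempty : Σ[ x₁ ∈ Carrier ] Σ[ x₂ ∈ Carrier ] B x₁ x₂
      labels   : ∀ x₁ x₂ → B x₁ x₂ → SameLabels x₁ x₂
      forth    : ∀ x₁ x₂ → B x₁ x₂ → ∀ S₁ → Nbhd space x₁ S₁ →
                   Σ[ S₂ ∈ Pred Carrier 0ℓ ] (Nbhd space x₂ S₂ × Matched B S₁ S₂)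
      back     : ∀ x₁ x₂ → B x₁ x₂ → ∀ S₂ → Nbhd space x₂ S₂ →
                   Σ[ S₁ ∈ Pred Carrier 0ℓ ] (Nbhd space x₁ S₁ × Matched B S₁ S₂)

  record IsPathBisimulation (B : Rel Carrier 0ℓ) : Set₁ where
    field
      nonempty : Σ[ x₁ ∈ Carrier ] Σ[ x₂ ∈ Carrier ] B x₁ x₂
      labels   : ∀ x₁ x₂ → B x₁ x₂ → SameLabels x₁ x₂
      fromF₁   : ∀ x₁ x₂ → B x₁ x₂ → (π₁ : BPathsF x₁) →
                   Σ[ π₂ ∈ BPathsF x₂ ] B (end (Data.Product.proj₁ π₁)) (end (Data.Product.proj₁ π₂))
      fromF₂   : ∀ x₁ x₂ → B x₁ x₂ → (π₂ : BPathsF x₂) →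
                   Σ[ π₁ ∈ BPathsF x₁ ] B (end (Data.Product.proj₁ π₁)) (end (Data.Product.proj₁ π₂))
      toT₁     : ∀ x₁ x₂ → B x₁ x₂ → (π₁ : BPathsT x₁) →
                   Σ[ π₂ ∈ BPathsT x₂ ] B (start (Data.Product.proj₁ π₁)) (start (Data.Product.proj₁ π₂))
      toT₂     : ∀ x₁ x₂ → B x₁ x₂ → (π₂ : BPathsT x₂) →
                   Σ[ π₁ ∈ BPathsT x₁ ] B (start (Data.Product.proj₁ π₁)) (start (Data.Product.proj₁ π₂))

  INLBisimilar : Carrier → Carrier → Set₁
  INLBisimilar x₁ x₂ = Σ[ B ∈ Rel Carrier 0ℓ ] (IsINLBisimulation B × B x₁ x₂)

  PathBisimilar : Carrier → Carrier → Set₁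
  PathBisimilar x₁ x₂ = Σ[ B ∈ Rel Carrier 0ℓ ] (IsPathBisimulation B × B x₁ x₂)

module Submission where

open import Defs
open import Level using (0ℓ)
open import Data.Product using (Σ-syntax; _,_; proj₁)
open import Data.Unit using (tt)
open import Relation.Unary using (U; ∅; ∁)
open import Relation.Binary using (Rel)
open import Relation.Binary.PropositionalEquality using (_≡_; subst; sym)

-- Since 𝒞 ∅ = ∅, the whole space is a neighbourhood of each of its points.  Matching
-- this neighbourhood in an INL-bisimulation relates every point on either side to
-- some point on the other; path-connectedness then supplies a path ending (or
-- starting) at whichever related point is required, so the INL-bisimulation is
-- itself a Path-bisimulation.

U-nbhd : (S : ClosureSpace) → ∀ x → Nbhd S x U
U-nbhd S x x∈𝒞∁U = 𝒞-∅ (𝒞-resp (∁ U) ∅ (λ ¬U → ¬U tt) (λ ()) x∈𝒞∁U)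
  where open ClosureSpace S

module _ {AP : Set} (𝒥 : IndexSpace) (M : ClosureModel AP) where
  open ClosureModel M
  open Paths 𝒥 M

  LeftTotal : Rel Carrier 0ℓ → Set
  LeftTotal B = ∀ y₁ → Σ[ y₂ ∈ Carrier ] B y₁ y₂

  RightTotal : Rel Carrier 0ℓ → Set
  RightTotal B = ∀ y₂ → Σ[ y₁ ∈ Carrier ] B y₁ y₂

  module _ {B : Rel Carrier 0ℓ} (isB : IsINLBisimulation B) where
    open IsINLBisimulation isB

    INLBisimulation⇒leftTotal : LeftTotal B
    INLBisimulation⇒leftTotal y₁ with nonempty
    ... | x₁ , x₂ , x₁Bx₂ with forth x₁ x₂ x₁Bx₂ U (U-nbhd space x₁)
    ...   | _ , _ , _ , matchU₁ with matchU₁ y₁ tt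
    ...     | y₂ , _ , y₁By₂ = y₂ , y₁By₂

    INLBisimulation⇒rightTotal : RightTotal B
    INLBisimulation⇒rightTotal y₂ with nonempty
    ... | x₁ , x₂ , x₁Bx₂ with back x₁ x₂ x₁Bx₂ U (U-nbhd space x₂)
    ...   | _ , _ , matchU₂ , _ with matchU₂ y₂ tt
    ...     | y₁ , _ , y₁By₂ = y₁ , y₁By₂

  module _ (pc : PathConnected) where

    pathFrom : ∀ x y → Σ[ π ∈ BPathsF x ] end (proj₁ π) ≡ y
    pathFrom x y with pc x y
    ... | π , start≡x , end≡y = (π , start≡x) , end≡y

    pathTo : ∀ x y → Σ[ π ∈ BPathsT y ] start (proj₁ π) ≡ x
    pathTo x y with pc x y
    ... | π , start≡x , end≡y = (π , end≡y) , start≡x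

    total⇒PathBisimulation : {B : Rel Carrier 0ℓ} →
      Σ[ x₁ ∈ Carrier ] Σ[ x₂ ∈ Carrier ] B x₁ x₂ →
      (∀ x₁ x₂ → B x₁ x₂ → SameLabels x₁ x₂) →
      LeftTotal B → RightTotal B → IsPathBisimulation B
    total⇒PathBisimulation {B} nonempty labels left right = record
      { nonempty = nonempty
      ; labels   = labels
      ; fromF₁   = λ _ x₂ _ π₁ → forward x₂ (end (proj₁ π₁))
      ; fromF₂   = λ x₁ _ _ π₂ → backward x₁ (end (proj₁ π₂))
      ; toT₁     = λ _ x₂ _ π₁ → forwardT x₂ (start (proj₁ π₁))
      ; toT₂     = λ x₁ _ _ π₂ → backwardT x₁ (start (proj₁ π₂))
      }
      where
      forward : ∀ x₂ y₁ → Σ[ π₂ ∈ BPathsF x₂ ] B y₁ (end (proj₁ π₂))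
      forward x₂ y₁ with left y₁
      ... | y₂ , y₁By₂ with pathFrom x₂ y₂
      ...   | π₂ , end≡y₂ = π₂ , subst (B y₁) (sym end≡y₂) y₁By₂

      backward : ∀ x₁ y₂ → Σ[ π₁ ∈ BPathsF x₁ ] B (end (proj₁ π₁)) y₂
      backward x₁ y₂ with right y₂
      ... | y₁ , y₁By₂ with pathFrom x₁ y₁
      ...   | π₁ , end≡y₁ = π₁ , subst (λ z → B z y₂) (sym end≡y₁) y₁By₂

      forwardT : ∀ x₂ y₁ → Σ[ π₂ ∈ BPathsT x₂ ] B y₁ (start (proj₁ π₂))
      forwardT x₂ y₁ with left y₁
      ... | y₂ , y₁By₂ with pathTo y₂ x₂
      ...   | π₂ , start≡y₂ = π₂ , subst (B y₁) (sym start≡y₂) y₁By₂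

      backwardT : ∀ x₁ y₂ → Σ[ π₁ ∈ BPathsT x₁ ] B (start (proj₁ π₁)) y₂
      backwardT x₁ y₂ with right y₂
      ... | y₁ , y₁By₂ with pathTo y₁ x₁
      ...   | π₁ , start≡y₁ = π₁ , subst (λ z → B z y₂) (sym start≡y₁) y₁By₂

proposition7 : {AP : Set} (𝒥 : IndexSpace) (M : ClosureModel AP) →
    Paths.PathConnected 𝒥 M →
    (x₁ x₂ : ClosureModel.Carrier M) →
    Paths.INLBisimilar 𝒥 M x₁ x₂ → Paths.PathBisimilar 𝒥 M x₁ x₂
proposition7 𝒥 M pc x₁ x₂ (B , isB , x₁Bx₂) =
  B , isPathBisimulation , x₁Bx₂
  where
  open Paths.IsINLBisimulation isB
  isPathBisimulation : Paths.IsPathBisimulation 𝒥 M B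
  isPathBisimulation =
    total⇒PathBisimulation 𝒥 M pc nonempty labels
      (INLBisimulation⇒leftTotal 𝒥 M isB) (INLBisimulation⇒rightTotal 𝒥 M isB)
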